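{- Given a word $T$ over a totally ordered alphabet, one can decide whether $T$ is a Galois word in $O(|T|)$ time using $O(1)$ additional working space.
   Context: Alternating order: for words $S,T$ with $S^\omega\neq T^\omega$ ($X^\omega$ is the infinite repetition of $X$), let $j$ be the first position with $S^\omega[j]\neq T^\omega[j]$; then $S\prec_{\mathrm{alt}}T$ if either $j$ is odd and $S^\omega[j]<T^\omega[j]$, or $j$ is even and $S^\omega[j]>T^\omega[j]$. A word is Galois if it is strictly smaller, with respect to $\prec_{\mathrm{alt}}$, than all its other cyclic rotations; in particular a Galois word is primitive (not of the form $U^k$ with $k\ge 2$). The model of computation is the word RAM with read-only access to $T$ and constant-time symbol comparisons. -}

module Defs where

open import Level using (0ℓ)
open import Data.Nat using (ℕ; zero; suc; _+_; _*_; _∸_; _<_; _≤_; _<ᵇ_; _≡ᵇ_; _/_; _%_)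
open import Data.Bool using (Bool; true; false; if_then_else_)
open import Data.Fin using (Fin)
open import Data.List using (List; []; _∷_; length; drop; take; _++_)
open import Data.Maybe using (Maybe; just; nothing)
open import Data.Product using (Σ; _×_; _,_; ∃)
open import Data.Sum using (_⊎_)
open import Data.Empty using (⊥)
open import Data.Unit using (⊤)
open import Data.Vec.Functional using (Vector; updateAt)
open import Relation.Binary.PropositionalEquality using (_≡_)
open import Relation.Binary.Bundles using (StrictTotalOrder)
open import Relation.Binary.Definitions using (Tri; tri<; tri≈; tri>)
open import Relation.Nullary using (¬_)

module Words (O : StrictTotalOrder 0ℓ 0ℓ 0ℓ) where
  open StrictTotalOrder O renaming (Carrier to A; _<_ to _<ₐ_; _≈_ to _≈ₐ_)

  nthD : A → List A → ℕ → A
  nthD d []       _       = d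
  nthD d (x ∷ xs) zero    = x
  nthD d (x ∷ xs) (suc i) = nthD d xs i

  -- S^ω[i] (0-based) for the nonempty word x ∷ xs
  omega : A → List A → ℕ → A
  omega x xs i = nthD x (x ∷ xs) (i % suc (length xs))

  -- The paper uses 1-based positions j: j odd ⇒ S^ω[j] < T^ω[j],
  -- j even ⇒ S^ω[j] > T^ω[j].  Here j is 0-based, so the parities swap.
  -- The first-difference position j exists iff S^ω ≠ T^ω (strictness of <).
  AltLess : List A → List A → Set
  AltLess (x ∷ xs) (y ∷ ys) =
    ∃ λ j → (∀ i → i < j → omega x xs i ≈ₐ omega y ys i)
          × ((j % 2 ≡ 0 × omega x xs j <ₐ omega y ys j)
             ⊎ (j % 2 ≡ 1 × omega y ys j <ₐ omega x xs j))
  AltLess _ _ = ⊥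

  rot : ℕ → List A → List A
  rot k T = drop k T ++ take k T

  Galois : List A → Set
  Galois T = 0 < length T × (∀ k → 0 < k → k < length T → AltLess T (rot k T))

-- A word-RAM-style machine: a constant number k of registers holding
-- natural numbers, read-only access to the input word T only through
-- its length and constant-time comparisons of symbols T[i], T[j].

data Op : Set where
  add sub mul quot rem : Op

evalOp : Op → ℕ → ℕ → ℕ
evalOp add  a b = a + b
evalOp sub  a b = a ∸ b
evalOp mul  a b = a * b
evalOp quot a zero    = 0
evalOp quot a (suc b) = a / suc b
evalOp rem  a zero    = 0
evalOp rem  a (suc b) = a % suc b

data Instr (k : ℕ) : Set where
  set    : Fin k → ℕ → Instr k
  len    : Fin k → Instr k
  arith  : Op → Fin k → Fin k → Fin k → Instr k
  jlt    : Fin k → Fin k → ℕ → Instr k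
  jmp    : ℕ → Instr k
  cmpsym : Fin k → Fin k → ℕ → ℕ → ℕ → Instr k    -- compare T[a],T[b] (0-based): goto t< / t= / t>
  halt   : Bool → Instr k

Program : ℕ → Set
Program k = List (Instr k)

record Config (k : ℕ) : Set where
  constructor ⟨_,_⟩
  field
    pc   : ℕ
    regs : Vector ℕ k

initial : ∀ {k} → Config k
initial = ⟨ 0 , (λ _ → 0) ⟩

data StepResult (k : ℕ) : Set where
  halted  : Bool → StepResult k
  next    : Config k → StepResult k
  crashed : StepResult k

fetch : ∀ {X : Set} → List X → ℕ → Maybe X
fetch []       _       = nothing
fetch (x ∷ xs) zero    = just x
fetch (x ∷ xs) (suc i) = fetch xs i

module Machine (O : StrictTotalOrder 0ℓ 0ℓ 0ℓ) where
  open StrictTotalOrder O using (compare) renaming (Carrier to A)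

  symAt : List A → ℕ → Maybe A
  symAt = fetch

  step : ∀ {k} → List A → Program k → Config k → StepResult k
  step {k} T P ⟨ p , r ⟩ with fetch P p
  ... | nothing = crashed
  ... | just (set d v)       = next ⟨ suc p , updateAt r d (λ _ → v) ⟩
  ... | just (len d)         = next ⟨ suc p , updateAt r d (λ _ → length T) ⟩
  ... | just (arith o d a b) = next ⟨ suc p , updateAt r d (λ _ → evalOp o (r a) (r b)) ⟩
  ... | just (jlt a b t)     = next ⟨ (if r a <ᵇ r b then t else suc p) , r ⟩
  ... | just (jmp t)         = next ⟨ t , r ⟩
  ... | just (halt b)        = halted b
  ... | just (cmpsym a b t< t= t>) with symAt T (r a) | symAt T (r b)
  ...   | just x | just y with compare x y
  ...     | tri< _ _ _ = next ⟨ t< , r ⟩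
  ...     | tri≈ _ _ _ = next ⟨ t= , r ⟩
  ...     | tri> _ _ _ = next ⟨ t> , r ⟩
  step T P ⟨ p , r ⟩ | just (cmpsym _ _ _ _ _) | _ | _ = crashed

  Bounded : ∀ {k} → ℕ → Config k → Set
  Bounded B c = ∀ i → Config.regs c i ≤ B

  Runs : ∀ {k} → List A → Program k → ℕ → ℕ → Config k → Bool → Set
  Runs T P zero      B c b = ⊥
  Runs T P (suc n) B c b with step T P c
  ... | halted b' = Bounded B c × b' ≡ b
  ... | next c'   = Bounded B c × Runs T P n B c' b
  ... | crashed   = ⊥

{-# OPTIONS --safe #-}
-- Tag the letter at position i of T^ω with the parity of i, and order tagged letters so that
-- parity 0 precedes parity 1, letters of parity 0 compare as in the alphabet and letters of
-- parity 1 in reverse. Comparing T with its rotation by k in the alternating order is then the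
-- ordinary lexicographic comparison of the tagged sequence X with its shift by k, where for odd k
-- the shifted sequence is tagged with flipped parities (Z 1). Shifts whose tags disagree with X
-- at position 0 are beaten automatically, so T is Galois iff X is lexicographically below all
-- shifts by 0 < k < |T| of Z 0 and of Z 1.
--
-- Lexicographic order is shift invariant, so the linear scan for minimal rotations applies: if
-- X agrees with the shift by j of Z q below p and is smaller at p, then X is also below the
-- shifts by all k from j to j + p, because it is below its own shift by k - j. Scanning the even and
-- then the odd shifts, j + p grows at every step and stays below 3|T|; the scan rejects when X is
-- larger at the first difference, or when X agrees with a shift on 2|T| positions, a common
-- period of all tagged sequences.
module Submission where

open import Defs
open import Level using (Level; 0ℓ; _⊔_)
open import Data.Nat using (ℕ; zero; suc; _+_; _*_; _^_; _∸_; _<_; _≤_; _<ᵇ_; _<?_; z≤n; s≤s; NonZero)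
open import Data.Nat.Properties
open import Data.Nat.DivMod
  using (_%_; _/_; m≡m%n+[m/n]*n; m%n<n; m<n⇒m%n≡m; [m+n]%n≡m%n; [m+kn]%n≡m%n; %-distribˡ-+; m%n%n≡m%n)
open import Data.Nat.Induction using (<-rec)
open import Data.Nat.Tactic.RingSolver using (solve-∀)
open import Data.Bool using (Bool; true; false; if_then_else_)
open import Data.Fin using (Fin; zero; suc)
open import Data.Fin.Patterns
open import Data.List using (List; []; _∷_; length; _++_; take; drop)
open import Data.List.Properties using (length-++; length-++-comm; take++drop≡id; length-take)
open import Data.Maybe using (just; nothing)
open import Data.Maybe.Properties using (just-injective)
open import Data.Product using (Σ; ∃; ∃₂; _×_; _,_; proj₁; proj₂)
open import Data.Sum using (_⊎_; inj₁; inj₂)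
open import Data.Sum.Relation.Binary.Pointwise using (inj₁; inj₂)
open import Data.Sum.Relation.Binary.LeftOrder using (⊎-<-strictPartialOrder; ₁∼₂; ₁∼₁; ₂∼₂)
open import Data.Vec using (_∷_; [])
import Data.Vec as Vec
open import Data.Vec.Functional using (Vector; updateAt; toVec; fromVec)
open import Data.Vec.Functional.Properties using (fromVec∘toVec)
open import Data.Empty using (⊥-elim)
open import Function.Base using (_∘_)
open import Function.Bundles using (_⇔_; mk⇔; Equivalence)
import Function.Properties.Equivalence as ⇔
open import Relation.Binary.Bundles using (StrictTotalOrder; StrictPartialOrder)
import Relation.Binary.Construct.Flip.EqAndOrd as Flip
open import Relation.Binary.Definitions using (Tri; tri<; tri≈; tri>)
open import Relation.Binary.PropositionalEquality
open import Relation.Nullary using (¬_; Dec; yes; no)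
open import Relation.Nullary.Reflects using (ofʸ; ofⁿ)

private variable
  a ℓ : Level
  E : Set a

-- Periodic sequences and lexicographic order

shift : ℕ → (ℕ → E) → ℕ → E
shift k f i = f (k + i)

Periodic : ℕ → (ℕ → E) → Set _
Periodic P f = ∀ i → f (i + P) ≡ f i

periodic-+* : ∀ {P} {f : ℕ → E} → Periodic P f → ∀ i m → f (i + m * P) ≡ f i
periodic-+* {P = P} {f} per i zero    = cong f (+-identityʳ i)
periodic-+* {P = P} {f} per i (suc m) = begin
  f (i + (P + m * P)) ≡⟨ cong f (trans (cong (i +_) (+-comm P (m * P))) (sym (+-assoc i (m * P) P))) ⟩
  f (i + m * P + P)   ≡⟨ per (i + m * P) ⟩
  f (i + m * P)       ≡⟨ periodic-+* per i m ⟩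
  f i                 ∎
  where open ≡-Reasoning

periodic-% : ∀ {P} .{{_ : NonZero P}} {f : ℕ → E} → Periodic P f → ∀ i → f i ≡ f (i % P)
periodic-% {P = P} {f} per i =
  trans (cong f (m≡m%n+[m/n]*n i P)) (periodic-+* per (i % P) (i / P))

shift-periodic : ∀ {P j} {f : ℕ → E} → Periodic P f → Periodic P (shift j f)
shift-periodic {P = P} {j} {f} per i = trans (cong f (sym (+-assoc j i P))) (per (j + i))

periodic-extend : ∀ {b} {F : Set b} {P} .{{_ : NonZero P}} (R : E → F → Set ℓ)
                  {f : ℕ → E} {g : ℕ → F} → Periodic P f → Periodic P g →
                  (∀ i → i < P → R (f i) (g i)) → ∀ i → R (f i) (g i)
periodic-extend {P = P} R {f} {g} perf perg below i =
  subst₂ R (sym (periodic-% perf i)) (sym (periodic-% perg i)) (below (i % P) (m%n<n i P))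

module Lexicographic {a ℓ₁ ℓ₂} (S : StrictPartialOrder a ℓ₁ ℓ₂) where
  open StrictPartialOrder S
    renaming (Carrier to C; _<_ to _≺_; trans to ≺-trans; irrefl to ≺-irrefl; asym to ≺-asym)

  AgreeBelow : ℕ → (ℕ → C) → (ℕ → C) → Set ℓ₁
  AgreeBelow p f g = ∀ i → i < p → f i ≈ g i

  infix 4 _≺ˡᵉˣ_
  _≺ˡᵉˣ_ : (ℕ → C) → (ℕ → C) → Set (ℓ₁ ⊔ ℓ₂)
  f ≺ˡᵉˣ g = ∃ λ p → AgreeBelow p f g × f p ≺ g p

  agreeBelow-suc : ∀ {p f g} → AgreeBelow p f g → f p ≈ g p → AgreeBelow (suc p) f g
  agreeBelow-suc f≈g fp≈gp i i<1+p with m<1+n⇒m<n∨m≡n i<1+p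
  ... | inj₁ i<p  = f≈g i i<p
  ... | inj₂ refl = fp≈gp

  agreeBelow-≤ : ∀ {m p f g} → m ≤ p → AgreeBelow p f g → AgreeBelow m f g
  agreeBelow-≤ m≤p f≈g i i<m = f≈g i (<-≤-trans i<m m≤p)

  ≺ˡᵉˣ-trans : ∀ {f g h} → f ≺ˡᵉˣ g → g ≺ˡᵉˣ h → f ≺ˡᵉˣ h
  ≺ˡᵉˣ-trans {f} {g} {h} (p , f≈g , f≺g) (q , g≈h , g≺h) with <-cmp p q
  ... | tri< p<q _ _ =
    p , (λ i i<p → Eq.trans (f≈g i i<p) (g≈h i (<-trans i<p p<q))) , <-respʳ-≈ (g≈h p p<q) f≺g
  ... | tri≈ _ refl _ = p , (λ i i<p → Eq.trans (f≈g i i<p) (g≈h i i<p)) , ≺-trans f≺g g≺h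
  ... | tri> _ _ q<p =
    q , (λ i i<q → Eq.trans (f≈g i (<-trans i<q q<p)) (g≈h i i<q)) , <-respˡ-≈ (Eq.sym (f≈g q q<p)) g≺h

  ≺ˡᵉˣ-respʳ-≗ : ∀ {f g h} → g ≗ h → f ≺ˡᵉˣ g → f ≺ˡᵉˣ h
  ≺ˡᵉˣ-respʳ-≗ {f} g≗h (p , f≈g , f≺g) =
    p , (λ i i<p → subst (f i ≈_) (g≗h i) (f≈g i i<p)) , subst (f p ≺_) (g≗h p) f≺g

  ≈⇒≮ˡᵉˣ : ∀ {f g} → (∀ i → f i ≈ g i) → ¬ f ≺ˡᵉˣ g
  ≈⇒≮ˡᵉˣ f≈g (p , _ , f≺g) = ≺-irrefl (f≈g p) f≺g

  ≻-at-first-difference⇒≮ˡᵉˣ : ∀ {f g p} → AgreeBelow p f g → g p ≺ f p → ¬ f ≺ˡᵉˣ g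
  ≻-at-first-difference⇒≮ˡᵉˣ {p = p} f≈g g≺f (q , f≈g′ , f≺g) with <-cmp q p
  ... | tri< q<p _ _ = ≺-irrefl (f≈g q q<p) f≺g
  ... | tri≈ _ refl _ = ≺-asym f≺g g≺f
  ... | tri> _ _ p<q = ≺-irrefl (Eq.sym (f≈g′ p p<q)) g≺f

  shift-≺ˡᵉˣ : ∀ {f g p t} → AgreeBelow p f g → f p ≺ g p → t ≤ p → shift t f ≺ˡᵉˣ shift t g
  shift-≺ˡᵉˣ {f} {g} {p} {t} f≈g f≺g t≤p =
    p ∸ t ,
    (λ i i<p∸t → f≈g (t + i) (subst (t + i <_) (m+[n∸m]≡n t≤p) (+-monoʳ-< t i<p∸t))) ,
    subst (λ k → f k ≺ g k) (sym (m+[n∸m]≡n t≤p)) f≺g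

  ≺ˡᵉˣ-skip : ∀ {f g j p k} → AgreeBelow p f (shift j g) → f p ≺ g (j + p) → j ≤ k → k ≤ j + p →
              (0 < k ∸ j → f ≺ˡᵉˣ shift (k ∸ j) f) → f ≺ˡᵉˣ shift k g
  ≺ˡᵉˣ-skip {f} {g} {j} {p} {k} f≈g f≺g j≤k k≤j+p f≺shift with k ∸ j | m+[n∸m]≡n j≤k | shifted
    where
    t≤p : k ∸ j ≤ p
    t≤p = subst (k ∸ j ≤_) (m+n∸m≡n j p) (∸-monoˡ-≤ j k≤j+p)
    shifted : shift (k ∸ j) f ≺ˡᵉˣ shift (j + (k ∸ j)) g
    shifted = ≺ˡᵉˣ-respʳ-≗ (λ i → cong g (sym (+-assoc j (k ∸ j) i)))
                           (shift-≺ˡᵉˣ {g = shift j g} f≈g f≺g t≤p)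
  ... | zero  | refl | s = s
  ... | suc t | refl | s = ≺ˡᵉˣ-trans (f≺shift (s≤s z≤n)) s

-- Rotations and the alternating order

module _ {A : Set} where

  fetch-++ˡ : ∀ (U V : List A) {i} → i < length U → fetch (U ++ V) i ≡ fetch U i
  fetch-++ˡ (u ∷ U) V {zero}  _         = refl
  fetch-++ˡ (u ∷ U) V {suc i} (s≤s i<U) = fetch-++ˡ U V i<U

  fetch-++ʳ : ∀ (U V : List A) i → fetch (U ++ V) (length U + i) ≡ fetch V i
  fetch-++ʳ []      V i = refl
  fetch-++ʳ (u ∷ U) V i = fetch-++ʳ U V i

m%2≡0⊎m%2≡1 : ∀ m → m % 2 ≡ 0 ⊎ m % 2 ≡ 1
m%2≡0⊎m%2≡1 m with m % 2 | m%n<n m 2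
... | 0 | _ = inj₁ refl
... | 1 | _ = inj₂ refl
... | suc (suc _) | s≤s (s≤s ())

m%2≡0⇒[m+i]%2≡i%2 : ∀ {m} i → m % 2 ≡ 0 → (m + i) % 2 ≡ i % 2
m%2≡0⇒[m+i]%2≡i%2 {m} i m-even = begin
  (m + i) % 2           ≡⟨ %-distribˡ-+ m i 2 ⟩
  (m % 2 + i % 2) % 2   ≡⟨ cong (λ r → (r + i % 2) % 2) m-even ⟩
  i % 2 % 2             ≡⟨ m%n%n≡m%n i 2 ⟩
  i % 2                 ∎
  where open ≡-Reasoning

module WordProperties (O : StrictTotalOrder 0ℓ 0ℓ 0ℓ) where
  open StrictTotalOrder O using (strictPartialOrder) renaming (Carrier to A; _<_ to _<ₐ_; _≈_ to _≈ₐ_)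
  open Words O

  omega-periodic : ∀ {x xs} → Periodic (suc (length xs)) (omega x xs)
  omega-periodic {x} {xs} i = cong (nthD x (x ∷ xs)) ([m+n]%n≡m%n i (suc (length xs)))

  fetch-omega : ∀ {x xs} i → fetch (x ∷ xs) (i % suc (length xs)) ≡ just (omega x xs i)
  fetch-omega {x} {xs} i = fetch-nthD (x ∷ xs) (m%n<n i (suc (length xs)))
    where
    fetch-nthD : ∀ L {i} → i < length L → fetch L i ≡ just (nthD x L i)
    fetch-nthD (y ∷ L) {zero}  _         = refl
    fetch-nthD (y ∷ L) {suc i} (s≤s i<L) = fetch-nthD L i<L

  fetch-omega-< : ∀ {x xs i} → i < suc (length xs) → fetch (x ∷ xs) i ≡ just (omega x xs i)
  fetch-omega-< {x} {xs} {i} i<n =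
    subst (λ k → fetch (x ∷ xs) k ≡ just (omega x xs i)) (m<n⇒m%n≡m i<n) (fetch-omega i)

  length-swap : ∀ {x : A} {xs} (U V : List A) {y ys} → U ++ V ≡ x ∷ xs → V ++ U ≡ y ∷ ys →
                suc (length ys) ≡ suc (length xs)
  length-swap U V UV≡ VU≡ = trans (cong length (sym VU≡)) (trans (length-++-comm V U) (cong length UV≡))

  omega-swap-below : ∀ {x xs} U V {y ys} → U ++ V ≡ x ∷ xs → V ++ U ≡ y ∷ ys →
                     ∀ i → i < suc (length xs) → omega y ys i ≡ omega x xs (length U + i)
  omega-swap-below {x} {xs} U V {y} {ys} UV≡ VU≡ i i<n = just-injective (by-position (i <? length V))
    where
    open ≡-Reasoning
    |U|+|V|≡n : length U + length V ≡ suc (length xs)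
    |U|+|V|≡n = trans (sym (length-++ U)) (cong length UV≡)
    fetch-VU : fetch (V ++ U) i ≡ just (omega y ys i)
    fetch-VU = trans (cong (λ L → fetch L i) VU≡)
                     (fetch-omega-< (subst (i <_) (sym (length-swap U V UV≡ VU≡)) i<n))
    by-position : Dec (i < length V) → just (omega y ys i) ≡ just (omega x xs (length U + i))
    by-position (yes i<V) = begin
      just (omega y ys i)              ≡⟨ sym fetch-VU ⟩
      fetch (V ++ U) i                 ≡⟨ fetch-++ˡ V U i<V ⟩
      fetch V i                        ≡⟨ sym (fetch-++ʳ U V i) ⟩
      fetch (U ++ V) (length U + i)    ≡⟨ cong (λ L → fetch L (length U + i)) UV≡ ⟩
      fetch (x ∷ xs) (length U + i)    ≡⟨ fetch-omega-< U+i<n ⟩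
      just (omega x xs (length U + i)) ∎
      where
      U+i<n : length U + i < suc (length xs)
      U+i<n = subst (length U + i <_) |U|+|V|≡n (+-monoʳ-< (length U) i<V)
    by-position (no i≮V) = begin
      just (omega y ys i)                  ≡⟨ sym fetch-VU ⟩
      fetch (V ++ U) i                     ≡⟨ cong (fetch (V ++ U)) (sym V+i′≡i) ⟩
      fetch (V ++ U) (length V + i′)       ≡⟨ fetch-++ʳ V U i′ ⟩
      fetch U i′                           ≡⟨ sym (fetch-++ˡ U V i′<U) ⟩
      fetch (U ++ V) i′                    ≡⟨ cong (λ L → fetch L i′) UV≡ ⟩
      fetch (x ∷ xs) i′                    ≡⟨ fetch-omega-< (<-≤-trans i′<U U≤n) ⟩
      just (omega x xs i′)                 ≡⟨ cong just (sym (omega-periodic i′)) ⟩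
      just (omega x xs (i′ + suc (length xs))) ≡⟨ cong (λ m → just (omega x xs m)) i′+n≡U+i ⟩
      just (omega x xs (length U + i))     ∎
      where
      i′ = i ∸ length V
      V+i′≡i : length V + i′ ≡ i
      V+i′≡i = m+[n∸m]≡n (≮⇒≥ i≮V)
      i′<U : i′ < length U
      i′<U = +-cancelˡ-< (length V) i′ (length U)
               (subst₂ _<_ (sym V+i′≡i) (trans (sym |U|+|V|≡n) (+-comm (length U) (length V))) i<n)
      U≤n : length U ≤ suc (length xs)
      U≤n = subst (length U ≤_) |U|+|V|≡n (m≤m+n _ _)
      i′+n≡U+i : i′ + suc (length xs) ≡ length U + i
      i′+n≡U+i = begin
        i′ + suc (length xs)            ≡⟨ cong (i′ +_) (sym |U|+|V|≡n) ⟩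
        i′ + (length U + length V)      ≡⟨ trans (+-comm i′ _) (+-assoc (length U) (length V) i′) ⟩
        length U + (length V + i′)      ≡⟨ cong (length U +_) V+i′≡i ⟩
        length U + i                    ∎

  omega-swap : ∀ {x xs} U V {y ys} → U ++ V ≡ x ∷ xs → V ++ U ≡ y ∷ ys →
               ∀ i → omega y ys i ≡ omega x xs (length U + i)
  omega-swap {x} {xs} U V {y} {ys} UV≡ VU≡ =
    periodic-extend _≡_ periodic-VU periodic-shifted (omega-swap-below U V UV≡ VU≡)
    where
    periodic-VU : Periodic (suc (length xs)) (omega y ys)
    periodic-VU = subst (λ m → Periodic m (omega y ys)) (length-swap U V UV≡ VU≡) omega-periodic
    periodic-shifted : Periodic (suc (length xs)) (λ i → omega x xs (length U + i))
    periodic-shifted i = trans (cong (omega x xs) (sym (+-assoc (length U) i _))) (omega-periodic (length U + i))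

  rot-omega : ∀ {x xs k} → k ≤ suc (length xs) →
              ∃₂ λ y ys → rot k (x ∷ xs) ≡ y ∷ ys × ∀ i → omega y ys i ≡ omega x xs (k + i)
  rot-omega {x} {xs} {k} k≤n with rot k (x ∷ xs) in rot≡
  ... | [] = ⊥-elim (0≢1+n (begin
    0                                        ≡⟨ cong length (sym rot≡) ⟩
    length (drop k (x ∷ xs) ++ take k (x ∷ xs)) ≡⟨ length-++-comm (drop k (x ∷ xs)) _ ⟩
    length (take k (x ∷ xs) ++ drop k (x ∷ xs)) ≡⟨ cong length (take++drop≡id k (x ∷ xs)) ⟩
    suc (length xs)                          ∎))
    where open ≡-Reasoning
  ... | y ∷ ys = y , ys , refl , λ i →
    subst (λ m → omega y ys i ≡ omega x xs (m + i)) |take|≡k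
      (omega-swap (take k (x ∷ xs)) (drop k (x ∷ xs)) (take++drop≡id k (x ∷ xs)) rot≡ i)
    where
    |take|≡k : length (take k (x ∷ xs)) ≡ k
    |take|≡k = trans (length-take k (x ∷ xs)) (m≤n⇒m⊓n≡m k≤n)

  Tagged : StrictPartialOrder 0ℓ 0ℓ 0ℓ
  Tagged = ⊎-<-strictPartialOrder strictPartialOrder (Flip.strictPartialOrder strictPartialOrder)

  open StrictPartialOrder Tagged public using () renaming (_<_ to _<ᵗ_; _≈_ to _≈ᵗ_)
  open Lexicographic Tagged public

  tag : ℕ → A → A ⊎ A
  tag zero    = inj₁
  tag (suc _) = inj₂

  tagged : ℕ → (ℕ → A) → ℕ → A ⊎ A
  tagged q s i = tag ((q + i) % 2) (s i)

  tag-≈ : ∀ t {u v} → u ≈ₐ v → tag t u ≈ᵗ tag t v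
  tag-≈ zero    u≈v = inj₁ u≈v
  tag-≈ (suc _) u≈v = inj₂ u≈v

  tag-≈⁻¹ : ∀ t {u v} → tag t u ≈ᵗ tag t v → u ≈ₐ v
  tag-≈⁻¹ zero    (inj₁ u≈v) = u≈v
  tag-≈⁻¹ (suc _) (inj₂ u≈v) = u≈v

  tag-<ᵗ : ∀ {t u v} → (t ≡ 0 × u <ₐ v ⊎ t ≡ 1 × v <ₐ u) → tag t u <ᵗ tag t v
  tag-<ᵗ (inj₁ (refl , u<v)) = ₁∼₁ u<v
  tag-<ᵗ (inj₂ (refl , v<u)) = ₂∼₂ v<u

  tag-<ᵗ⁻¹ : ∀ {t u v} → t < 2 → tag t u <ᵗ tag t v → (t ≡ 0 × u <ₐ v ⊎ t ≡ 1 × v <ₐ u)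
  tag-<ᵗ⁻¹ {0}           _ (₁∼₁ u<v) = inj₁ (refl , u<v)
  tag-<ᵗ⁻¹ {1}           _ (₂∼₂ v<u) = inj₂ (refl , v<u)
  tag-<ᵗ⁻¹ {suc (suc _)} (s≤s (s≤s ()))

  tag-<ᵗ-tag : ∀ {s t u v} → s < t → t < 2 → tag s u <ᵗ tag t v
  tag-<ᵗ-tag {zero}  {suc zero} _ _       = ₁∼₂
  tag-<ᵗ-tag {suc _} {suc zero} (s≤s ()) _
  tag-<ᵗ-tag {_}     {suc (suc _)} _ (s≤s (s≤s ()))

  altLess⇔≺ˡᵉˣ : ∀ {x xs y ys} →
                 AltLess (x ∷ xs) (y ∷ ys) ⇔ tagged 0 (omega x xs) ≺ˡᵉˣ tagged 0 (omega y ys)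
  altLess⇔≺ˡᵉˣ = mk⇔
    (λ (j , agree , at-j) → j , (λ i i<j → tag-≈ (i % 2) (agree i i<j)) , tag-<ᵗ at-j)
    (λ (j , agree , at-j) → j , (λ i i<j → tag-≈⁻¹ (i % 2) (agree i i<j)) , tag-<ᵗ⁻¹ (m%n<n j 2) at-j)

  module ShiftComparisons (x : A) (xs : List A) where

    n : ℕ
    n = suc (length xs)

    Z : ℕ → ℕ → A ⊎ A
    Z q = tagged q (omega x xs)

    X : ℕ → A ⊎ A
    X = Z 0

    BelowShifts : ℕ → ℕ → Set
    BelowShifts q j = ∀ k → 0 < k → k < j → k < n → X ≺ˡᵉˣ shift k (Z q)

    altLess-rot⇔ : ∀ {q k} → k < n → (q + k) % 2 ≡ 0 →
                   AltLess (x ∷ xs) (rot k (x ∷ xs)) ⇔ X ≺ˡᵉˣ shift k (Z q)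
    altLess-rot⇔ {q} {k} k<n q+k-even with rot-omega {x} {xs} (<⇒≤ k<n)
    ... | y , ys , rot≡ , omega≡ = mk⇔
      (λ alt → ≺ˡᵉˣ-respʳ-≗ same (Equivalence.to altLess⇔≺ˡᵉˣ (subst (AltLess (x ∷ xs)) rot≡ alt)))
      (λ lt → subst (AltLess (x ∷ xs)) (sym rot≡)
                    (Equivalence.from altLess⇔≺ˡᵉˣ (≺ˡᵉˣ-respʳ-≗ (sym ∘ same) lt)))
      where
      same : tagged 0 (omega y ys) ≗ shift k (Z q)
      same i = cong₂ tag (sym tags) (omega≡ i)
        where
        tags : (q + (k + i)) % 2 ≡ i % 2
        tags = trans (cong (_% 2) (sym (+-assoc q k i))) (m%2≡0⇒[m+i]%2≡i%2 {q + k} i q+k-even)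

    shift-of-other-parity : ∀ {q k} → (q + k) % 2 ≡ 1 → X ≺ˡᵉˣ shift k (Z q)
    shift-of-other-parity {q} {k} q+k-odd =
      0 , (λ _ ()) , tag-<ᵗ-tag (subst (0 <_) (sym q+k+0-odd) (s≤s z≤n)) (m%n<n (q + (k + 0)) 2)
      where
      q+k+0-odd : (q + (k + 0)) % 2 ≡ 1
      q+k+0-odd = trans (cong (λ m → (q + m) % 2) (+-identityʳ k)) q+k-odd

    galois⇔belowShifts : Galois (x ∷ xs) ⇔ (BelowShifts 0 n × BelowShifts 1 n)
    galois⇔belowShifts = mk⇔
      (λ (_ , galois) → below galois 0 , below galois 1)
      (λ (below₀ , below₁) → s≤s z≤n ,
         λ k 0<k k<n → rotation below₀ below₁ k 0<k k<n (m%2≡0⊎m%2≡1 k))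
      where
      below : (∀ k → 0 < k → k < n → AltLess (x ∷ xs) (rot k (x ∷ xs))) → ∀ q → BelowShifts q n
      below galois q k 0<k _ k<n with m%2≡0⊎m%2≡1 (q + k)
      ... | inj₁ even = Equivalence.to (altLess-rot⇔ {q} k<n even) (galois k 0<k k<n)
      ... | inj₂ odd  = shift-of-other-parity {q} odd
      rotation : BelowShifts 0 n → BelowShifts 1 n → ∀ k → 0 < k → k < n → k % 2 ≡ 0 ⊎ k % 2 ≡ 1 →
                 AltLess (x ∷ xs) (rot k (x ∷ xs))
      rotation below₀ _ k 0<k k<n (inj₁ even) =
        Equivalence.from (altLess-rot⇔ {0} k<n even) (below₀ k 0<k k<n k<n)
      rotation _ below₁ k 0<k k<n (inj₂ odd) =
        Equivalence.from (altLess-rot⇔ {1} k<n (trans (%-distribˡ-+ 1 k 2) (cong (λ r → (1 + r) % 2) odd)))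
                         (below₁ k 0<k k<n k<n)

    belowShifts-extend₀ : ∀ {j p} → 0 < j → BelowShifts 0 j → AgreeBelow p X (shift j X) →
                          X p <ᵗ X (j + p) → BelowShifts 0 (suc (j + p))
    -- Induction on k, since the self-shift by k ∸ j used for k may itself be one of the new shifts.
    belowShifts-extend₀ {j} {p} 0<j below agree X<ᵗ k = <-rec Claim claim k
      where
      Claim : ℕ → Set
      Claim k = 0 < k → k < suc (j + p) → k < n → X ≺ˡᵉˣ shift k X
      claim : ∀ k → (∀ {t} → t < k → Claim t) → Claim k
      claim k rec 0<k k≤j+p k<n with k <? j
      ... | yes k<j = below k 0<k k<j k<n
      ... | no  k≮j = ≺ˡᵉˣ-skip {g = X} agree X<ᵗ (≮⇒≥ k≮j) (≤-pred k≤j+p)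
                        (λ 0<t → rec t<k 0<t (<-trans t<k k≤j+p) (<-trans t<k k<n))
        where
        t<k : k ∸ j < k
        t<k = ∸-monoʳ-< 0<j (≮⇒≥ k≮j)

    belowShifts-extend : ∀ {q j p} → BelowShifts 0 n → BelowShifts q j → AgreeBelow p X (shift j (Z q)) →
                         X p <ᵗ Z q (j + p) → BelowShifts q (suc (j + p))
    belowShifts-extend {q} {j} {p} below₀ below agree X<ᵗ k 0<k k≤j+p k<n with k <? j
    ... | yes k<j = below k 0<k k<j k<n
    ... | no  k≮j = ≺ˡᵉˣ-skip {g = Z q} agree X<ᵗ (≮⇒≥ k≮j) (≤-pred k≤j+p)
                      (λ 0<t → below₀ (k ∸ j) 0<t t<n t<n)
      where
      t<n : k ∸ j < n
      t<n = ≤-<-trans (m∸n≤m k j) k<n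

    Z-periodic : ∀ q → Periodic (n + n) (Z q)
    Z-periodic q i = cong₂ tag tags-agree letters-agree
      where
      tags-agree : (q + (i + (n + n))) % 2 ≡ (q + i) % 2
      tags-agree = trans (cong (_% 2) (regroup q i n)) ([m+kn]%n≡m%n (q + i) n 2)
        where
        regroup : ∀ q i n → q + (i + (n + n)) ≡ q + i + n * 2
        regroup = solve-∀
      letters-agree : omega x xs (i + (n + n)) ≡ omega x xs i
      letters-agree = trans (cong (omega x xs) (sym (+-assoc i n n)))
                            (trans (omega-periodic (i + n)) (omega-periodic i))

    ≮ˡᵉˣ-if-agree-on-two-periods : ∀ {q j} → AgreeBelow (n + n) X (shift j (Z q)) →
                                   ¬ X ≺ˡᵉˣ shift j (Z q)
    ≮ˡᵉˣ-if-agree-on-two-periods {q} agree =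
      ≈⇒≮ˡᵉˣ (periodic-extend _≈ᵗ_ (Z-periodic 0) (shift-periodic (Z-periodic q)) agree)

-- Machine runs

updateAt-resp : ∀ {n} {A : Set} {r r′ : Vector A n} d {f : A → A} → r ≗ r′ →
                updateAt r d f ≗ updateAt r′ d f
updateAt-resp zero {f} r≗r′ zero = cong f (r≗r′ zero)
updateAt-resp zero    r≗r′ (suc i) = r≗r′ (suc i)
updateAt-resp (suc d) r≗r′ zero    = r≗r′ zero
updateAt-resp (suc d) r≗r′ (suc i) = updateAt-resp d (r≗r′ ∘ suc) i

updateAt-≤ : ∀ {n B} {r : Vector ℕ n} d {v} → (∀ i → r i ≤ B) → v ≤ B →
             ∀ i → updateAt r d (λ _ → v) i ≤ B
updateAt-≤ zero    r≤B v≤B zero    = v≤B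
updateAt-≤ zero    r≤B v≤B (suc i) = r≤B (suc i)
updateAt-≤ (suc d) r≤B v≤B zero    = r≤B zero
updateAt-≤ (suc d) r≤B v≤B (suc i) = updateAt-≤ d (r≤B ∘ suc) v≤B i

toVec-≡⇒≗ : ∀ {n} {A : Set} {r r′ : Vector A n} → toVec r ≡ toVec r′ → r ≗ r′
toVec-≡⇒≗ {r = r} {r′} eq i =
  trans (sym (fromVec∘toVec r i)) (trans (cong (λ v → fromVec v i) eq) (fromVec∘toVec r′ i))

module Deciding (O : StrictTotalOrder 0ℓ 0ℓ 0ℓ) {k : ℕ}
                (T : List (StrictTotalOrder.Carrier O)) (P : Program k) (B : ℕ) where
  open StrictTotalOrder O using (compare) renaming (_<_ to _<ₐ_; _≈_ to _≈ₐ_)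
  open Machine O

  Fits : Vector ℕ k → Set
  Fits r = ∀ i → r i ≤ B

  runs-mono : ∀ {F F′ c b} → F ≤ F′ → Runs T P F B c b → Runs T P F′ B c b
  runs-mono {suc F} {suc F′} {c} (s≤s F≤F′) run with step T P c
  ... | halted _ = run
  ... | next c′  = let fits , run′ = run in fits , runs-mono F≤F′ run′

  data SameStep : StepResult k → StepResult k → Set where
    halted  : ∀ b → SameStep (halted b) (halted b)
    next    : ∀ {pc r r′} → r ≗ r′ → SameStep (next ⟨ pc , r ⟩) (next ⟨ pc , r′ ⟩)
    crashed : SameStep crashed crashed

  step-resp : ∀ {pc r r′} → r ≗ r′ → SameStep (step T P ⟨ pc , r ⟩) (step T P ⟨ pc , r′ ⟩)
  step-resp {pc} {r} {r′} r≗r′ with fetch P pc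
  ... | nothing                 = crashed
  ... | just (set d v)          = next (updateAt-resp d r≗r′)
  ... | just (len d)            = next (updateAt-resp d r≗r′)
  ... | just (arith o d a b)    rewrite r≗r′ a | r≗r′ b = next (updateAt-resp d r≗r′)
  ... | just (jlt a b t)        rewrite r≗r′ a | r≗r′ b = next r≗r′
  ... | just (jmp t)            = next r≗r′
  ... | just (halt b)           = halted b
  ... | just (cmpsym a b _ _ _) rewrite r≗r′ a | r≗r′ b with fetch T (r′ a) | fetch T (r′ b)
  ...   | just u  | just v with compare u v
  ...     | tri< _ _ _ = next r≗r′
  ...     | tri≈ _ _ _ = next r≗r′
  ...     | tri> _ _ _ = next r≗r′
  step-resp r≗r′ | just (cmpsym _ _ _ _ _) | just _  | nothing = crashed
  step-resp r≗r′ | just (cmpsym _ _ _ _ _) | nothing | _       = crashed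

  runs-resp : ∀ {F pc r r′ b} → r ≗ r′ → Runs T P F B ⟨ pc , r ⟩ b → Runs T P F B ⟨ pc , r′ ⟩ b
  runs-resp {suc F} {pc} {r} {r′} r≗r′ run
    with step T P ⟨ pc , r ⟩ | step T P ⟨ pc , r′ ⟩ | step-resp {pc} r≗r′
  ... | halted b | halted .b | halted .b =
    let fits , b≡ = run in (λ i → subst (_≤ B) (r≗r′ i) (fits i)) , b≡
  ... | next _   | next _    | next s≗s′ =
    let fits , run′ = run in (λ i → subst (_≤ B) (r≗r′ i) (fits i)) , runs-resp {F} s≗s′ run′

  record Decides (F : ℕ) (c : Config k) (S : Set) : Set where
    constructor decided
    field
      answer  : Bool
      runs    : Runs T P F B c answer
      correct : answer ≡ true ⇔ S

  decides-mono : ∀ {F F′ c S} → F ≤ F′ → Decides F c S → Decides F′ c S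
  decides-mono F≤F′ (decided b run b⇔S) = decided b (runs-mono F≤F′ run) b⇔S

  decides-⇔ : ∀ {F c S S′} → S ⇔ S′ → Decides F c S → Decides F c S′
  decides-⇔ S⇔S′ (decided b run b⇔S) = decided b run (⇔.trans b⇔S S⇔S′)

  decides-resp : ∀ {F pc r r′ S} → toVec r ≡ toVec r′ → Decides F ⟨ pc , r ⟩ S →
                 Decides F ⟨ pc , r′ ⟩ S
  decides-resp {F} {pc} {r} {r′} same (decided b run b⇔S) =
    decided b (runs-resp {F} {pc} (toVec-≡⇒≗ {r = r} {r′} same) run) b⇔S

  decides-next : ∀ {F pc r c′ S} → step T P ⟨ pc , r ⟩ ≡ next c′ → Fits r → Decides F c′ S →
                 Decides (suc F) ⟨ pc , r ⟩ S
  decides-next {F} {pc} {r} step≡ fits (decided b run b⇔S) = decided b run′ b⇔S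
    where
    run′ : Runs T P (suc F) B ⟨ pc , r ⟩ b
    run′ rewrite step≡ = fits , run

  decides-update : ∀ {F pc r S} d v → step T P ⟨ pc , r ⟩ ≡ next ⟨ suc pc , updateAt r d (λ _ → v) ⟩ →
                   Fits r → v ≤ B →
                   (Fits (updateAt r d (λ _ → v)) → Decides F ⟨ suc pc , updateAt r d (λ _ → v) ⟩ S) →
                   Decides (suc F) ⟨ pc , r ⟩ S
  decides-update d v step≡ fits v≤B continue = decides-next step≡ fits (continue (updateAt-≤ d fits v≤B))

  decides-halt : ∀ {F pc r b S} → step T P ⟨ pc , r ⟩ ≡ halted b → Fits r → (b ≡ true ⇔ S) →
                 Decides (suc F) ⟨ pc , r ⟩ S
  decides-halt {F} {pc} {r} {b} step≡ fits b⇔S = decided b run b⇔S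
    where
    run : Runs T P (suc F) B ⟨ pc , r ⟩ b
    run rewrite step≡ = fits , refl

  decides-reject : ∀ {F pc r S} → step T P ⟨ pc , r ⟩ ≡ halted false → Fits r → ¬ S →
                   Decides (suc F) ⟨ pc , r ⟩ S
  decides-reject step≡ fits ¬S = decides-halt step≡ fits (mk⇔ (λ ()) (⊥-elim ∘ ¬S))

  decides-jlt : ∀ {F pc r a b t S} → fetch P pc ≡ just (jlt a b t) → Fits r →
                (r a < r b → Decides F ⟨ t , r ⟩ S) → (r b ≤ r a → Decides F ⟨ suc pc , r ⟩ S) →
                Decides (suc F) ⟨ pc , r ⟩ S
  decides-jlt {pc = pc} {r} {a} {b} {t} fetch≡ fits less not-less
    with r a <ᵇ r b | <ᵇ-reflects-< (r a) (r b) | step-jlt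
    where
    step-jlt : step T P ⟨ pc , r ⟩ ≡ next ⟨ (if r a <ᵇ r b then t else suc pc) , r ⟩
    step-jlt rewrite fetch≡ = refl
  ... | true  | ofʸ ra<rb  | step≡ = decides-next step≡ fits (less ra<rb)
  ... | false | ofⁿ ra≮rb  | step≡ = decides-next step≡ fits (not-less (≮⇒≥ ra≮rb))

  branch : ∀ {u v} → ℕ → ℕ → ℕ → Tri (u <ₐ v) (u ≈ₐ v) (v <ₐ u) → ℕ
  branch t< t≈ t> (tri< _ _ _) = t<
  branch t< t≈ t> (tri≈ _ _ _) = t≈
  branch t< t≈ t> (tri> _ _ _) = t>

  step-cmpsym : ∀ {pc r a b t< t≈ t> u v} → fetch P pc ≡ just (cmpsym a b t< t≈ t>) →
                fetch T (r a) ≡ just u → fetch T (r b) ≡ just v →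
                step T P ⟨ pc , r ⟩ ≡ next ⟨ branch t< t≈ t> (compare u v) , r ⟩
  step-cmpsym {u = u} {v} fetch≡ u≡ v≡ rewrite fetch≡ | u≡ | v≡ with compare u v
  ... | tri< _ _ _ = refl
  ... | tri≈ _ _ _ = refl
  ... | tri> _ _ _ = refl

  decides-cmpsym : ∀ {F pc r a b t< t≈ t> u v S} → fetch P pc ≡ just (cmpsym a b t< t≈ t>) →
                   fetch T (r a) ≡ just u → fetch T (r b) ≡ just v → Fits r →
                   (u <ₐ v → Decides F ⟨ t< , r ⟩ S) → (u ≈ₐ v → Decides F ⟨ t≈ , r ⟩ S) →
                   (v <ₐ u → Decides F ⟨ t> , r ⟩ S) → Decides (suc F) ⟨ pc , r ⟩ S
  decides-cmpsym {u = u} {v} fetch≡ u≡ v≡ fits less equal greater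
    with compare u v | step-cmpsym fetch≡ u≡ v≡
  ... | tri< u<v _ _ | step≡ = decides-next step≡ fits (less u<v)
  ... | tri≈ _ u≈v _ | step≡ = decides-next step≡ fits (equal u≈v)
  ... | tri> _ _ v<u | step≡ = decides-next step≡ fits (greater v<u)

-- The program

Rn R2n Rj Rp Rq R1 R2 Ra Rb Rc Rd : Fin 11
Rn  = 0F
R2n = 1F
Rj  = 2F
Rp  = 3F
Rq  = 4F
R1  = 5F
R2  = 6F
Ra  = 7F
Rb  = 8F
Rc  = 9F
Rd  = suc 9F

phaseFuel : ℕ → ℕ → ℕ
phaseFuel n E = (n + (n + n)) * 15 + suc E

galoisFuel : ℕ → ℕ
galoisFuel n = 6 + (2 + phaseFuel n (5 + phaseFuel n 2))

registers : (n j p q a b c d : ℕ) → Vector ℕ 11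
registers n j p q a b c d = Vec.lookup (n ∷ n + n ∷ j ∷ p ∷ q ∷ 1 ∷ 2 ∷ a ∷ b ∷ c ∷ d ∷ [])

galoisProgram : Program 11
galoisProgram =
  len Rn ∷
  arith add R2n Rn Rn ∷
  set R1 1 ∷
  set R2 2 ∷
  jlt Rq Rn 6 ∷              -- Rq still holds its initial 0
  halt false ∷
  set Rj 1 ∷                 -- 6: a phase starts
  set Rp 0 ∷
  jlt Rj Rn 11 ∷             -- 8: loop head
  jlt Rq R1 29 ∷
  halt true ∷
  arith add Ra Rj Rp ∷       -- 11: compare the tags of X p and Z q (j + p)
  arith add Rb Rq Ra ∷
  arith rem Rb Rb R2 ∷
  arith rem Rc Rp R2 ∷
  jlt Rc Rb 22 ∷
  jlt Rb Rc 28 ∷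
  arith rem Ra Ra Rn ∷       -- 17: equal tags, compare the letters
  arith rem Rd Rp Rn ∷
  jlt Rc R1 21 ∷
  cmpsym Rd Ra 28 26 22 ∷    -- 20: odd tags compare letters in reverse
  cmpsym Rd Ra 22 26 28 ∷
  arith add Rj Rj Rp ∷       -- 22: X p is smaller
  arith add Rj R1 Rj ∷
  set Rp 0 ∷
  jmp 8 ∷
  arith add Rp R1 Rp ∷       -- 26: X p and Z q (j + p) are equal
  jlt Rp R2n 8 ∷
  halt false ∷               -- 28
  set Rq 1 ∷                 -- 29: the phase for odd shifts
  jmp 6 ∷
  []

module GaloisProgram (O : StrictTotalOrder 0ℓ 0ℓ 0ℓ) where
  open StrictTotalOrder O using () renaming (Carrier to A)
  open WordProperties O
  open Words O using (Galois; omega)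

  module Blocks (T : List A) (B : ℕ) (room : length T + (length T + length T) + 2 ≤ B) where
    open Deciding O T galoisProgram B public

    private
      n = length T

    ≤B : ∀ {v} → v ≤ n + (n + n) → v ≤ B
    ≤B v≤3n = ≤-trans v≤3n (≤-trans (m≤m+n _ 2) room)

    2≤B : 2 ≤ B
    2≤B = ≤-trans (m≤n+m 2 _) room

    1≤B : 1 ≤ B
    1≤B = ≤-trans (n≤1+n 1) 2≤B

    %2≤B : ∀ m → m % 2 ≤ B
    %2≤B m = ≤-trans (<⇒≤ (m%n<n m 2)) 2≤B

    DecidesFrom : (pc j p q F : ℕ) → Set → Set
    DecidesFrom pc j p q F S = ∀ {a b c d} → Fits (registers n j p q a b c d) →
                               Decides F ⟨ pc , registers n j p q a b c d ⟩ S

    -- For a concrete chain of register updates toVec computes, so the first premise is refl.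
    via-registers : ∀ {F pc r r′ S} → toVec r ≡ toVec r′ → Fits r → (Fits r′ → Decides F ⟨ pc , r′ ⟩ S) →
                    Decides F ⟨ pc , r ⟩ S
    via-registers {F} {pc} {r} {r′} same fits continue =
      decides-resp {F} {pc} {r′} {r} (sym same)
        (continue (λ i → subst (_≤ B) (toVec-≡⇒≗ {r = r} {r′} same i) (fits i)))

    setup : ∀ {F S} → (0 < n → DecidesFrom 6 0 0 0 F S) → (¬ 0 < n → ¬ S) → Decides (6 + F) initial S
    setup continue give-up =
      decides-update Rn n refl (λ _ → z≤n) (≤B (m≤m+n n _)) λ fits →
      decides-update R2n (n + n) refl fits (≤B (m≤n+m _ n)) λ fits →
      decides-update R1 1 refl fits 1≤B λ fits →
      decides-update R2 2 refl fits 2≤B λ fits →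
      decides-jlt refl fits
        (λ 0<n → decides-mono (n≤1+n _) (via-registers refl fits (continue 0<n)))
        (λ n≤0 → decides-reject refl fits (give-up (≤⇒≯ n≤0)))

    phase-start : ∀ {S j p q F} → DecidesFrom 8 1 0 q F S → DecidesFrom 6 j p q (2 + F) S
    phase-start continue fits =
      decides-update Rj 1 refl fits 1≤B λ fits →
      decides-update Rp 0 refl fits z≤n λ fits →
      via-registers refl fits continue

    skip-block : ∀ {S j p q F} → suc (j + p) ≤ B → DecidesFrom 8 (suc (j + p)) 0 q F S →
                 DecidesFrom 22 j p q (4 + F) S
    skip-block {j = j} {p} bound continue fits =
      decides-update Rj (j + p) refl fits (≤-trans (n≤1+n _) bound) λ fits →
      decides-update Rj (suc (j + p)) refl fits bound λ fits →
      decides-update Rp 0 refl fits z≤n λ fits →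
      decides-next refl fits (via-registers refl fits continue)

    advance-block : ∀ {S j p q F} → suc p ≤ B → (suc p < n + n → DecidesFrom 8 j (suc p) q F S) →
                    (n + n ≤ suc p → ¬ S) → DecidesFrom 26 j p q (3 + F) S
    advance-block {p = p} bound continue give-up fits =
      decides-update Rp (suc p) refl fits bound λ fits →
      decides-jlt refl fits
        (λ p+1<2n → decides-mono (n≤1+n _) (via-registers refl fits (continue p+1<2n)))
        (λ 2n≤p+1 → decides-reject refl fits (give-up 2n≤p+1))

  module OnNonemptyWord (x : A) (xs : List A) (B : ℕ)
                        (room : suc (length xs) + (suc (length xs) + suc (length xs)) + 2 ≤ B) where
    open ShiftComparisons x xs
    open Blocks (x ∷ xs) B room

    record Handlers (S : Set) (j p q F : ℕ) (u v : A ⊎ A) : Set where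
      field
        on-less    : u <ᵗ v → DecidesFrom 22 j p q F S
        on-equal   : u ≈ᵗ v → DecidesFrom 26 j p q F S
        on-greater : v <ᵗ u → ¬ S
    open Handlers

    %n≤B : ∀ m → m % n ≤ B
    %n≤B m = ≤B (≤-trans (<⇒≤ (m%n<n m n)) (m≤m+n n _))

    compare-letters : ∀ {S j p q F d} → p % 2 ≡ (q + (j + p)) % 2 →
                      Handlers S j p q (suc F) (X p) (Z q (j + p)) →
                      Fits (registers n j p q (j + p) ((q + (j + p)) % 2) (p % 2) d) →
                      Decides (5 + F) ⟨ 17 , registers n j p q (j + p) ((q + (j + p)) % 2) (p % 2) d ⟩ S
    compare-letters {S} {j} {p} {q} {F} same h fits =
      decides-update Ra ((j + p) % n) refl fits (%n≤B (j + p)) λ fits →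
      decides-update Rd (p % n) refl fits (%n≤B p) λ fits →
      decides-jlt refl fits
        (λ p%2<1 → let h₀ = handlers-at (n<1⇒n≡0 p%2<1) in
          decides-cmpsym refl (fetch-omega p) (fetch-omega (j + p)) fits
            (λ u<v → via-registers refl fits (on-less h₀ (₁∼₁ u<v)))
            (λ u≈v → via-registers refl fits (on-equal h₀ (inj₁ u≈v)))
            (λ v<u → decides-reject refl fits (on-greater h₀ (₁∼₁ v<u))))
        (λ 1≤p%2 → let h₁ = handlers-at (≤-antisym (≤-pred (m%n<n p 2)) 1≤p%2) in
          decides-cmpsym refl (fetch-omega p) (fetch-omega (j + p)) fits
            (λ u<v → decides-reject refl fits (on-greater h₁ (₂∼₂ u<v)))
            (λ u≈v → via-registers refl fits (on-equal h₁ (inj₂ u≈v)))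
            (λ v<u → via-registers refl fits (on-less h₁ (₂∼₂ v<u))))
      where
      handlers-at : ∀ {t} → p % 2 ≡ t →
                    Handlers S j p q (suc F) (tag t (omega x xs p)) (tag t (omega x xs (j + p)))
      handlers-at p%2≡t = subst₂ (Handlers S j p q (suc F)) (cong (λ t → tag t (omega x xs p)) p%2≡t)
                                 (cong (λ t → tag t (omega x xs (j + p))) (trans (sym same) p%2≡t)) h

    compare-step : ∀ {S j p q F} → j < n → p < n + n → q ≤ 1 →
                   Handlers S j p q (suc F) (X p) (Z q (j + p)) →
                   DecidesFrom 11 j p q (11 + F) S
    compare-step {S} {j} {p} {q} {F} j<n p<2n q≤1 h fits =
      decides-update Ra (j + p) refl fits (≤B (<⇒≤ j+p<3n)) λ fits →
      decides-update Rb (q + (j + p)) refl fits (≤B (≤-trans (+-monoˡ-≤ (j + p) q≤1) j+p<3n)) λ fits →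
      decides-update Rb ((q + (j + p)) % 2) refl fits (%2≤B (q + (j + p))) λ fits →
      decides-update Rc (p % 2) refl fits (%2≤B p) λ fits →
      decides-jlt refl fits
        (λ X<Z → decides-mono (m≤n+m _ 5)
                   (via-registers refl fits (on-less h (tag-<ᵗ-tag X<Z (m%n<n (q + (j + p)) 2)))))
        (λ Z≤X → decides-jlt refl fits
          (λ Z<X → decides-reject refl fits (on-greater h (tag-<ᵗ-tag Z<X (m%n<n p 2))))
          (λ X≤Z → via-registers refl fits (compare-letters (≤-antisym X≤Z Z≤X) h)))
      where
      j+p<3n : j + p < n + (n + n)
      j+p<3n = +-mono-< j<n p<2n

    module Phase (S : Set) (q : ℕ) (q≤1 : q ≤ 1) (S⇒below : S → BelowShifts q n)
                 (extend : ∀ {j p} → 0 < j → BelowShifts q j → AgreeBelow p X (shift j (Z q)) →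
                           X p <ᵗ Z q (j + p) → BelowShifts q (suc (j + p)))
                 (E : ℕ) (finish : ∀ {j p} → BelowShifts q n → DecidesFrom 9 j p q E S) where

      rejected-at : ∀ {j} → 0 < j → j < n → ¬ X ≺ˡᵉˣ shift j (Z q) → ¬ S
      rejected-at 0<j j<n ≮ s = ≮ (S⇒below s _ 0<j j<n j<n)

      widen : ∀ {j} → n ≤ j → BelowShifts q j → BelowShifts q n
      widen n≤j below k 0<k k<n = below k 0<k (<-≤-trans k<n n≤j)

      loop : ∀ m {j p} → n + (n + n) ≤ m + (j + p) → 0 < j → p < n + n → BelowShifts q j →
             AgreeBelow p X (shift j (Z q)) → DecidesFrom 8 j p q (m * 15 + suc E) S
      loop zero {j} {p} measure 0<j p<2n below agree fits = decides-jlt refl fits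
        (λ j<n → ⊥-elim (<⇒≱ (+-mono-< j<n p<2n) measure))
        (λ n≤j → finish (widen n≤j below) fits)
      loop (suc m) {j} {p} measure 0<j p<2n below agree fits = decides-jlt refl fits
        (λ j<n → compare-step j<n p<2n q≤1 (handlers j<n) fits)
        (λ n≤j → decides-mono (≤-trans (n≤1+n E) (m≤n+m (suc E) (14 + m * 15)))
                              (finish (widen n≤j below) fits))
        where
        next-measure : ∀ {s} → s ≡ suc (j + p) → n + (n + n) ≤ m + s
        next-measure refl = subst (n + (n + n) ≤_) (sym (+-suc m (j + p))) measure
        handlers : j < n → Handlers S j p q (4 + (m * 15 + suc E)) (X p) (Z q (j + p))
        handlers j<n = record
          { on-less    = λ X<Z → skip-block (≤B j+p<3n)
                           (loop m (next-measure (+-identityʳ _)) (s≤s z≤n) 0<2n (extend 0<j below agree X<Z) (λ _ ()))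
          ; on-equal   = λ X≈Z fits →
                           decides-mono (n≤1+n _) (advance-block p+1≤B (continue X≈Z) (give-up X≈Z) fits)
          ; on-greater = λ Z<X → rejected-at 0<j j<n (≻-at-first-difference⇒≮ˡᵉˣ agree Z<X)
          }
          where
          j+p<3n : j + p < n + (n + n)
          j+p<3n = +-mono-< j<n p<2n
          0<2n : 0 < n + n
          0<2n = ≤-trans (s≤s z≤n) p<2n
          p+1≤B : suc p ≤ B
          p+1≤B = ≤B (≤-trans p<2n (m≤n+m _ n))
          continue : X p ≈ᵗ Z q (j + p) → suc p < n + n → DecidesFrom 8 j (suc p) q (m * 15 + suc E) S
          continue X≈Z p+1<2n = loop m (next-measure (+-suc j p)) 0<j p+1<2n below (agreeBelow-suc agree X≈Z)
          give-up : X p ≈ᵗ Z q (j + p) → n + n ≤ suc p → ¬ S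
          give-up X≈Z 2n≤p+1 = rejected-at 0<j j<n
            (≮ˡᵉˣ-if-agree-on-two-periods {q} {j} (agreeBelow-≤ 2n≤p+1 (agreeBelow-suc agree X≈Z)))

      run : DecidesFrom 8 1 0 q (phaseFuel n E) S
      run = loop (n + (n + n)) (m≤m+n _ _) (s≤s z≤n) (≤-trans (s≤s z≤n) (m≤m+n n n))
                 (λ k 0<k k<1 → ⊥-elim (<⇒≱ 0<k (≤-pred k<1))) (λ _ ())

    phase₁ : BelowShifts 0 n → DecidesFrom 8 1 0 1 (phaseFuel n 2) (BelowShifts 1 n)
    phase₁ below₀ =
      Phase.run (BelowShifts 1 n) 1 ≤-refl (λ below₁ → below₁) (λ _ → belowShifts-extend {1} below₀) 2 accept
      where
      accept : ∀ {j p} → BelowShifts 1 n → DecidesFrom 9 j p 1 2 (BelowShifts 1 n)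
      accept below₁ fits = decides-jlt refl fits
        (λ 1<1 → ⊥-elim (<-irrefl refl 1<1))
        (λ _ → decides-halt refl fits (mk⇔ (λ _ → below₁) (λ _ → refl)))

    phase₀ : DecidesFrom 8 1 0 0 (phaseFuel n (5 + phaseFuel n 2)) (BelowShifts 0 n × BelowShifts 1 n)
    phase₀ = Phase.run (BelowShifts 0 n × BelowShifts 1 n) 0 z≤n proj₁ belowShifts-extend₀ _ next-phase
      where
      next-phase : ∀ {j p} → BelowShifts 0 n →
                   DecidesFrom 9 j p 0 (5 + phaseFuel n 2) (BelowShifts 0 n × BelowShifts 1 n)
      next-phase below₀ fits = decides-jlt refl fits
        (λ _ → decides-update Rq 1 refl fits 1≤B λ fits →
               decides-next refl fits (via-registers refl fits (phase-start λ fits →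
                 decides-⇔ (mk⇔ (below₀ ,_) proj₂) (phase₁ below₀ fits))))
        (λ 1≤0 → ⊥-elim (<-irrefl refl 1≤0))

    from-start : DecidesFrom 6 0 0 0 (2 + phaseFuel n (5 + phaseFuel n 2)) (Galois (x ∷ xs))
    from-start = phase-start λ fits → decides-⇔ (⇔.sym galois⇔belowShifts) (phase₀ fits)

galoisFuel≤ : ∀ n → galoisFuel n ≤ 100 * (n + 1)
galoisFuel≤ n = begin
  galoisFuel n                  ≤⟨ m≤m+n _ (83 + 10 * n) ⟩
  galoisFuel n + (83 + 10 * n)  ≡⟨ regroup n ⟩
  100 * (n + 1)                 ∎
  where
  open ≤-Reasoning
  regroup : ∀ n → 6 + (2 + ((n + (n + n)) * 15 + suc (5 + ((n + (n + n)) * 15 + 3)))) + (83 + 10 * n) ≡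
                  100 * (n + 1)
  regroup = solve-∀

3n+2≤[n+2]^100 : ∀ n → n + (n + n) + 2 ≤ (n + 2) ^ 100
3n+2≤[n+2]^100 n = begin
  n + (n + n) + 2                    ≤⟨ m≤m+n _ (n * n + n + 2) ⟩
  n + (n + n) + 2 + (n * n + n + 2)  ≡⟨ square n ⟩
  (n + 2) ^ 2                        ≤⟨ ^-monoʳ-≤ (n + 2) {{nonZero}} {2} {100} (s≤s (s≤s z≤n)) ⟩
  (n + 2) ^ 100                      ∎
  where
  open ≤-Reasoning
  square : ∀ n → n + (n + n) + 2 + (n * n + n + 2) ≡ (n + 2) * ((n + 2) * 1)
  square = solve-∀
  nonZero : NonZero (n + 2)
  nonZero = subst NonZero (+-comm 2 n) _

module _ (O : StrictTotalOrder 0ℓ 0ℓ 0ℓ) where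
  open GaloisProgram O
  open Words O using (Galois)
  open Deciding O using (Decides)

  galois-decided : ∀ T B → length T + (length T + length T) + 2 ≤ B →
                   Decides T galoisProgram B (100 * (length T + 1)) initial (Galois T)
  galois-decided []       B room =
    decides-mono (galoisFuel≤ 0) (setup (λ ()) (λ ¬0<n galois → ¬0<n (proj₁ galois)))
    where open Blocks [] B room
  galois-decided (x ∷ xs) B room = decides-mono (galoisFuel≤ (length (x ∷ xs)))
    (setup (λ _ → OnNonemptyWord.from-start x xs B room) (λ ¬0<n galois → ¬0<n (proj₁ galois)))
    where open Blocks (x ∷ xs) B room

theorem25 : Σ ℕ λ k → Σ (Program k) λ P → Σ ℕ λ c →
    (O : StrictTotalOrder 0ℓ 0ℓ 0ℓ) → (T : List (StrictTotalOrder.Carrier O)) →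
    Σ Bool λ b →
      Machine.Runs O T P (c * (length T + 1)) ((length T + 2) ^ c) initial b
      × ((b ≡ true) ⇔ Words.Galois O T)
theorem25 = 11 , galoisProgram , 100 , λ O T →
  let open Deciding.Decides (galois-decided O T ((length T + 2) ^ 100) (3n+2≤[n+2]^100 (length T))) in
  answer , runs , correct
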